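{- If $s$ is a pure $+$-term, then $s\lesssim_{ACh}h(t)$ if and only if $s\lesssim_{ACh}t$.
   Context: Terms are over $\{+,h,0\}$, variables and free constants. A pure $+$-term is a term built only from variables and $+$ (no constants and no $h$). $ACh$ is the theory generated by associativity and commutativity of $+$ and $h(x+y)\approx h(x)+h(y)$. $s\lesssim_{ACh}t$ means there is a substitution $\sigma$ with $s\sigma=_{ACh}t$. -}

module Defs where

open import Data.Nat using (ℕ)
open import Data.Product using (Σ)
open import Relation.Binary.PropositionalEquality using (_≡_)

infixl 6 _⊕_

data Term : Set where
  var  : ℕ → Term
  cst  : ℕ → Term
  𝟘    : Term
  _⊕_  : Term → Term → Term
  h    : Term → Term

Subst : Set
Subst = ℕ → Term

_[_] : Term → Subst → Term
var x   [ σ ] = σ x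
cst c   [ σ ] = cst c
𝟘       [ σ ] = 𝟘
(s ⊕ t) [ σ ] = (s [ σ ]) ⊕ (t [ σ ])
h s     [ σ ] = h (s [ σ ])

infix 4 _=ACh_
data _=ACh_ : Term → Term → Set where
  ≈refl  : ∀ {s} → s =ACh s
  ≈sym   : ∀ {s t} → s =ACh t → t =ACh s
  ≈trans : ∀ {s t u} → s =ACh t → t =ACh u → s =ACh u
  ≈cong⊕ : ∀ {s s' t t'} → s =ACh s' → t =ACh t' → s ⊕ t =ACh s' ⊕ t'
  ≈congh : ∀ {s s'} → s =ACh s' → h s =ACh h s'
  assoc  : ∀ x y z → (x ⊕ y) ⊕ z =ACh x ⊕ (y ⊕ z)
  comm   : ∀ x y → x ⊕ y =ACh y ⊕ x
  hdist  : ∀ x y → h (x ⊕ y) =ACh h x ⊕ h y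

infix 4 _≲ACh_
_≲ACh_ : Term → Term → Set
s ≲ACh t = Σ Subst (λ σ → s [ σ ] =ACh t)

data Pure : Term → Set where
  pvar : ∀ x → Pure (var x)
  p⊕   : ∀ {s t} → Pure s → Pure t → Pure (s ⊕ t)

-- Matching h t against h ∘ σ is immediate, since h distributes over + and
-- a pure s is built from variables by + alone. Conversely, peeling one h off
-- every summand (unh) sends h t to t and respects =ACh, because hdist only
-- moves an h across a +; for a pure s it turns σ into a matcher unh ∘ σ for t.
module Submission where

open import Defs
open import Data.Product using (_×_; _,_)
open import Function using (_∘_)

[]-∘-pure : ∀ (f : Term → Term) → (∀ a b → f (a ⊕ b) =ACh f a ⊕ f b) →
            ∀ {s} (σ : Subst) → Pure s → s [ f ∘ σ ] =ACh f (s [ σ ])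
[]-∘-pure f f-⊕ σ (pvar x) = ≈refl
[]-∘-pure f f-⊕ σ (p⊕ p q) =
  ≈trans (≈cong⊕ ([]-∘-pure f f-⊕ σ p) ([]-∘-pure f f-⊕ σ q)) (≈sym (f-⊕ _ _))

unh : Term → Term
unh (var x) = var x
unh (cst c) = cst c
unh 𝟘       = 𝟘
unh (a ⊕ b) = unh a ⊕ unh b
unh (h a)   = a

unh-resp : ∀ {u v} → u =ACh v → unh u =ACh unh v
unh-resp ≈refl         = ≈refl
unh-resp (≈sym p)      = ≈sym (unh-resp p)
unh-resp (≈trans p q)  = ≈trans (unh-resp p) (unh-resp q)
unh-resp (≈cong⊕ p q)  = ≈cong⊕ (unh-resp p) (unh-resp q)
unh-resp (≈congh p)    = p
unh-resp (assoc x y z) = assoc (unh x) (unh y) (unh z)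
unh-resp (comm x y)    = comm (unh x) (unh y)
unh-resp (hdist x y)   = ≈refl

≲-unh-pure : ∀ {s t} → Pure s → s ≲ACh h t → s ≲ACh t
≲-unh-pure ps (σ , e) =
  unh ∘ σ , ≈trans ([]-∘-pure unh (λ _ _ → ≈refl) σ ps) (unh-resp e)

≲-h-pure : ∀ {s t} → Pure s → s ≲ACh t → s ≲ACh h t
≲-h-pure ps (σ , e) = h ∘ σ , ≈trans ([]-∘-pure h hdist σ ps) (≈congh e)

mainTheorem12 : ∀ (s t : Term) → Pure s →
    ((s ≲ACh h t → s ≲ACh t) × (s ≲ACh t → s ≲ACh h t))
mainTheorem12 s t ps = ≲-unh-pure ps , ≲-h-pure ps
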